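{- Let $\chi$ be a finite partial map from timestamps (natural numbers) to write events, let $\sigma$ be a sequence listing every timestamp of $\operatorname{dom}\chi$ exactly once, let $\tau$ be a partial function from timestamps to natural numbers with $\operatorname{dom}\tau\subseteq\operatorname{dom}\chi$, and let $\kappa:\operatorname{dom}\chi\to\{\mathsf{green},\mathsf{yellow},\mathsf{red}\}$. Assume that for all $t_1\in\operatorname{dom}\tau$ and $t_2\in\operatorname{dom}\chi$, if $\tau(t_1)<t_2$ then $t_1<_\sigma t_2$. If $t\in\operatorname{dom}\chi$ and $\kappa(s)=\mathsf{green}$ for every $s$ with $s\le_\sigma t$, then $$\{s \mid s\ \Omega\ t\} \;=\; \{s \mid s\le_\sigma t\}.$$
   Context: Timestamps are natural numbers; $\chi$ (the history) maps timestamps to write events $(p,v)$. For timestamps $t_1,t_2$ occurring in $\sigma$, $t_1\le_\sigma t_2$ means $t_1$ occurs in $\sigma$ no later than $t_2$, and $t_1<_\sigma t_2$ means $t_1$ occurs strictly before $t_2$. The function $\tau$ records ending times of terminated events. The relation $\Omega$ is defined by: $t_1\ \Omega\ t_2$ iff $t_1=t_2$, or ($t_1\in\operatorname{dom}\tau$ and $\tau(t_1)<t_2$), or ($t_1<_\sigma t_2$ and $\kappa(t_1)=\mathsf{green}$). -}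

module Defs where

open import Data.Nat using (ℕ; _≤_; _<_)
open import Data.Fin using (Fin; toℕ)
open import Data.List using (List; lookup)
open import Data.Maybe using (Maybe; just; nothing)
open import Data.Product using (Σ; ∃; _×_; _,_)
open import Data.Sum using (_⊎_)
open import Relation.Binary.PropositionalEquality using (_≡_)

data Colour : Set where
  green yellow red : Colour

WriteEvent : Set → Set → Set
WriteEvent P V = P × V

History : Set → Set → Set
History P V = ℕ → Maybe (WriteEvent P V)

_∈dom_ : {A : Set} → ℕ → (ℕ → Maybe A) → Set
t ∈dom f = ∃ λ a → f t ≡ just a

_≤[_]_ : ℕ → List ℕ → ℕ → Set
t₁ ≤[ σ ] t₂ = Σ (Fin _) λ i → Σ (Fin _) λ j →
  (toℕ i ≤ toℕ j) × (lookup σ i ≡ t₁) × (lookup σ j ≡ t₂)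

_<[_]_ : ℕ → List ℕ → ℕ → Set
t₁ <[ σ ] t₂ = Σ (Fin _) λ i → Σ (Fin _) λ j →
  (toℕ i < toℕ j) × (lookup σ i ≡ t₁) × (lookup σ j ≡ t₂)

Ω : List ℕ → (ℕ → Maybe ℕ) → (ℕ → Colour) → ℕ → ℕ → Set
Ω σ τ κ t₁ t₂ =
  (t₁ ≡ t₂)
  ⊎ (∃ λ e → τ t₁ ≡ just e × e < t₂)
  ⊎ (t₁ <[ σ ] t₂ × κ t₁ ≡ green)

-- Every disjunct of s Ω t places s no later than t in σ; conversely s ≤σ t is either s <σ t,
-- where s is green by hypothesis, or the same position, where s = t.
module Submission where

open import Defs
open import Data.Nat using (ℕ; _<_)
open import Data.Nat.Properties using (≤-refl; <⇒≤; m≤n⇒m<n∨m≡n)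
open import Data.Fin.Properties using (toℕ-injective)
open import Data.List using (List; lookup)
open import Data.List.Membership.Propositional using (_∈_)
open import Data.List.Relation.Unary.Any using (index)
open import Data.List.Relation.Unary.Any.Properties using (lookup-index)
open import Data.List.Relation.Unary.Unique.Propositional using (Unique)
open import Data.Maybe using (Maybe; just)
open import Data.Product using (_×_; _,_)
open import Data.Sum using (_⊎_; inj₁; inj₂)
open import Function.Bundles using (_⇔_; mk⇔; Equivalence)
open import Relation.Binary.PropositionalEquality using (_≡_; refl; sym; trans; cong)

module Positions (σ : List ℕ) where

  ≤σ-refl : ∀ {t} → t ∈ σ → t ≤[ σ ] t
  ≤σ-refl t∈σ = index t∈σ , index t∈σ , ≤-refl , eq , eq
    where eq = sym (lookup-index t∈σ)

  <σ⇒≤σ : ∀ {s t} → s <[ σ ] t → s ≤[ σ ] t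
  <σ⇒≤σ (i , j , i<j , p , q) = i , j , <⇒≤ i<j , p , q

  ≤σ⇒<σ⊎≡ : ∀ {s t} → s ≤[ σ ] t → s <[ σ ] t ⊎ s ≡ t
  ≤σ⇒<σ⊎≡ (i , j , i≤j , p , q) with m≤n⇒m<n∨m≡n i≤j
  ... | inj₁ i<j = inj₁ (i , j , i<j , p , q)
  ... | inj₂ i≡j = inj₂ (trans (sym p) (trans (cong (lookup σ) (toℕ-injective i≡j)) q))

lemma2 : {P V : Set} (χ : History P V) (σ : List ℕ) (τ : ℕ → Maybe ℕ) (κ : ℕ → Colour) →
    Unique σ →
    (∀ t → t ∈ σ ⇔ t ∈dom χ) →
    (∀ t → t ∈dom τ → t ∈dom χ) →
    (∀ t₁ t₂ e → τ t₁ ≡ just e → t₂ ∈dom χ → e < t₂ → t₁ <[ σ ] t₂) →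
    (t : ℕ) → t ∈dom χ →
    (∀ s → s ≤[ σ ] t → κ s ≡ green) →
    ∀ s → Ω σ τ κ s t ⇔ s ≤[ σ ] t
lemma2 χ σ τ κ _ σ≡domχ _ τ-ordered t t∈χ green-prefix s = mk⇔ Ω⇒≤σ ≤σ⇒Ω
  where
  open Positions σ

  Ω⇒≤σ : Ω σ τ κ s t → s ≤[ σ ] t
  Ω⇒≤σ (inj₁ refl)                   = ≤σ-refl (Equivalence.from (σ≡domχ t) t∈χ)
  Ω⇒≤σ (inj₂ (inj₁ (e , τs≡e , e<t))) = <σ⇒≤σ (τ-ordered s t e τs≡e t∈χ e<t)
  Ω⇒≤σ (inj₂ (inj₂ (s<t , _)))        = <σ⇒≤σ s<t

  ≤σ⇒Ω : s ≤[ σ ] t → Ω σ τ κ s t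
  ≤σ⇒Ω s≤t with ≤σ⇒<σ⊎≡ s≤t
  ... | inj₁ s<t = inj₂ (inj₂ (s<t , green-prefix s s≤t))
  ... | inj₂ s≡t = inj₁ s≡t
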